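{- Let $w$ be a nonempty finite word containing a square. Write $w=psq$, where $sq$ is the longest square-free suffix of $w$ and $p[-1]s$ is the longest square prefix of $p[-1]sq$ (this decomposition exists and is unique, with $p$ and $s$ nonempty). Then $L(psq)=p\,L(sq)$ if and only if the prefixes of length $2|ps|$ of $L(psq)$ and of $p\,L(sq)$ are equal.
   Context: Words are over $\mathbb{N}=\{0,1,2,\dots\}$; $p[-1]$ denotes the last letter of $p$ and $|u|$ the length of $u$. A square is a nonempty word $yy$; square-free means no square factor. For words $u,v$, $u\prec v$ means there is $i$ with $u[:i]=v[:i]$ and $u[i]<v[i]$ ($u[:i]$ the prefix of length $i$, $u[i]$ the letter at position $i$, indexing from $0$). For a finite word $w$ (not necessarily square-free), $L(w)$ is the lexicographically least infinite word over $\mathbb{N}$ that begins with $w$ and whose only square factors are contained in the prefix $w$. -}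

module Defs where

open import Data.Nat using (ℕ; zero; suc; _+_; _*_; _≤_; _<_)
open import Data.List using (List; []; _∷_; _++_; [_]; length)
open import Data.Product using (Σ; ∃; ∃-syntax; _×_; _,_)
open import Relation.Binary.PropositionalEquality using (_≡_; _≢_)
open import Relation.Nullary using (¬_)

Word : Set
Word = List ℕ

InfWord : Set
InfWord = ℕ → ℕ

IsSquare : Word → Set
IsSquare x = ∃[ y ] (y ≢ [] × x ≡ y ++ y)

HasSquare : Word → Set
HasSquare w = ∃[ u ] ∃[ y ] ∃[ v ] (y ≢ [] × w ≡ u ++ (y ++ y) ++ v)

SquareFree : Word → Set
SquareFree w = ¬ HasSquare w

IsSuffix : Word → Word → Set
IsSuffix t w = ∃[ u ] (w ≡ u ++ t)

IsPrefix : Word → Word → Set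
IsPrefix x w = ∃[ v ] (w ≡ x ++ v)

IsLongestSquareFreeSuffix : Word → Word → Set
IsLongestSquareFreeSuffix t w =
  IsSuffix t w × SquareFree t ×
  (∀ t′ → IsSuffix t′ w → SquareFree t′ → length t′ ≤ length t)

IsLongestSquarePrefix : Word → Word → Set
IsLongestSquarePrefix x z =
  IsPrefix x z × IsSquare x ×
  (∀ x′ → IsPrefix x′ z → IsSquare x′ → length x′ ≤ length x)

LastLetter : Word → ℕ → Set
LastLetter p a = ∃[ p′ ] (p ≡ p′ ++ [ a ])

pref : InfWord → ℕ → Word
pref f zero    = []
pref f (suc n) = f 0 ∷ pref (λ i → f (suc i)) n

_++ω_ : Word → InfWord → InfWord
([]    ++ω f) i       = f i
((a ∷ u) ++ω f) zero    = a
((a ∷ u) ++ω f) (suc i) = (u ++ω f) i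

BeginsWith : InfWord → Word → Set
BeginsWith f w = pref f (length w) ≡ w

SquareAt : InfWord → ℕ → ℕ → Set
SquareAt f i n = 0 < n × (∀ k → k < n → f (i + k) ≡ f (i + n + k))

SquaresWithin : InfWord → ℕ → Set
SquaresWithin f m = ∀ i n → SquareAt f i n → i + 2 * n ≤ m

_≺_ : InfWord → InfWord → Set
f ≺ g = ∃[ i ] ((∀ j → j < i → f j ≡ g j) × f i < g i)

Admissible : Word → InfWord → Set
Admissible w f = BeginsWith f w × SquaresWithin f (length w)

IsL : Word → InfWord → Set
IsL w f = Admissible w f × (∀ g → Admissible w g → ¬ (g ≺ f))

{-# OPTIONS --safe #-}
-- Write h = p L(sq).  Deleting the prefix p from L(psq) leaves an admissible word for
-- sq, so L(psq) is never lexicographically below h; hence L(psq) = h as soon as h is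
-- admissible for psq, and it remains to confine the squares of h to psq.  A square of h
-- starting at or after |p| is a square of L(sq), hence inside sq; one ending within the
-- first 2|ps| letters is, by the hypothesis, a square of L(psq), hence inside psq.  Any
-- other square starts inside p and ends beyond 2|ps|, so its first half contains the
-- square p[-1]s; shifting that square by the period gives a square of L(sq), which lies
-- inside sq, contradicting that sq is square-free.
module Submission where

open import Defs
open import Data.Nat using (ℕ; zero; suc; _+_; _*_; _≤_; _<_; s≤s; z<s; _≤?_)
open import Data.Nat.Properties
open import Data.Nat.Induction using (<-rec)
open import Data.Nat.Tactic.RingSolver using (solve-∀)
open import Data.List using ([]; _∷_; _++_; [_]; length)
open import Data.List.Properties using (length-++; ++-assoc; ∷-injectiveˡ; ∷-injectiveʳ)
open import Data.Product using (_,_; proj₁; proj₂)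
open import Data.Empty using (⊥-elim)
open import Function.Bundles using (_⇔_; mk⇔; Equivalence)
open import Relation.Nullary using (¬_; yes; no)
open import Relation.Binary using (tri<; tri≈; tri>)
open import Relation.Binary.PropositionalEquality
  using (_≡_; _≢_; _≗_; refl; sym; trans; cong; cong₂; subst; module ≡-Reasoning)

dropω : ℕ → InfWord → InfWord
dropω k f i = f (k + i)

++ω-dropω : ∀ u g → dropω (length u) (u ++ω g) ≗ g
++ω-dropω []      g k = refl
++ω-dropω (x ∷ u) g k = ++ω-dropω u g k

pref-cong : ∀ {f g} n → (∀ k → k < n → f k ≡ g k) → pref f n ≡ pref g n
pref-cong zero    _     = refl
pref-cong (suc n) agree =
  cong₂ _∷_ (agree 0 z<s) (pref-cong n (λ k k<n → agree (suc k) (s≤s k<n)))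

pref-agree : ∀ {f g} n {k} → pref f n ≡ pref g n → k < n → f k ≡ g k
pref-agree (suc n) {zero}  eq _         = ∷-injectiveˡ eq
pref-agree (suc n) {suc k} eq (s≤s k<n) = pref-agree n (∷-injectiveʳ eq) k<n

pref-+ : ∀ f m n → pref f (m + n) ≡ pref f m ++ pref (dropω m f) n
pref-+ f zero    n = refl
pref-+ f (suc m) n = cong (f 0 ∷_) (pref-+ (dropω 1 f) m n)

pref-nonempty : ∀ f {n} → 0 < n → pref f n ≢ []
pref-nonempty f {suc n} _ ()

BeginsWith-++⁻ˡ : ∀ {f} u {v} → BeginsWith f (u ++ v) → BeginsWith f u
BeginsWith-++⁻ˡ []      _  = refl
BeginsWith-++⁻ˡ (x ∷ u) eq =
  cong₂ _∷_ (∷-injectiveˡ eq) (BeginsWith-++⁻ˡ u (∷-injectiveʳ eq))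

BeginsWith-dropω : ∀ {f} u {v} → BeginsWith f (u ++ v) → BeginsWith (dropω (length u) f) v
BeginsWith-dropω []      eq = eq
BeginsWith-dropω (x ∷ u) eq = BeginsWith-dropω u (∷-injectiveʳ eq)

BeginsWith-++ω : ∀ u {g v} → BeginsWith g v → BeginsWith (u ++ω g) (u ++ v)
BeginsWith-++ω []      eq = eq
BeginsWith-++ω (x ∷ u) eq = cong (x ∷_) (BeginsWith-++ω u eq)

SquareAt-dropω : ∀ {f} k {i n} → SquareAt (dropω k f) i n ⇔ SquareAt f (k + i) n
SquareAt-dropω {f} k {i} {n} = mk⇔
  (λ (0<n , period) → 0<n , λ m m<n →
    trans (cong f (+-assoc k i m)) (trans (period m m<n) (cong f (sym (reassoc k i n m)))))
  (λ (0<n , period) → 0<n , λ m m<n →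
    trans (cong f (sym (+-assoc k i m))) (trans (period m m<n) (cong f (reassoc k i n m))))
  where
  reassoc : ∀ k i n m → k + i + n + m ≡ k + (i + n + m)
  reassoc = solve-∀

SquareAt-resp-≗ : ∀ {f g i n} → f ≗ g → SquareAt f i n → SquareAt g i n
SquareAt-resp-≗ {i = i} {n} f≗g (0<n , period) = 0<n , λ m m<n →
  trans (sym (f≗g (i + m))) (trans (period m m<n) (f≗g (i + n + m)))

SquareAt-++ω⁻ : ∀ u {g i n} → SquareAt (u ++ω g) (length u + i) n → SquareAt g i n
SquareAt-++ω⁻ u {g} {i} sq =
  SquareAt-resp-≗ (++ω-dropω u g) (Equivalence.from (SquareAt-dropω {u ++ω g} (length u) {i}) sq)

SquaresWithin-dropω : ∀ {f} k {m} → SquaresWithin f (k + m) → SquaresWithin (dropω k f) m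
SquaresWithin-dropω {f} k {m} within i n sq =
  +-cancelˡ-≤ k (i + 2 * n) m
    (subst (_≤ k + m) (+-assoc k i (2 * n))
      (within (k + i) n (Equivalence.to (SquareAt-dropω {f} k) sq)))

SquaresWithin-++ω : ∀ u {g m j n} → SquaresWithin g m → length u ≤ j →
  SquareAt (u ++ω g) j n → j + 2 * n ≤ length u + m
SquaresWithin-++ω u {g} {m} {j} {n} within u≤j sq with m≤n⇒∃[o]m+o≡n u≤j
... | i , refl = subst (_≤ length u + m) (sym (+-assoc (length u) i (2 * n)))
                   (+-monoʳ-≤ (length u) (within i n (SquareAt-++ω⁻ u sq)))

SquareAt-pref : ∀ {f g N i n} → pref f N ≡ pref g N → i + 2 * n ≤ N →
  SquareAt g i n → SquareAt f i n
SquareAt-pref {f} {g} {N} {i} {n} agree bound (0<n , period) = 0<n , λ m m<n →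
  trans (pref-agree N agree (<-≤-trans (first m<n) inside))
        (trans (period m m<n) (sym (pref-agree N agree (<-≤-trans (second m<n) inside))))
  where
  inside : i + n + n ≤ N
  inside = subst (_≤ N) (i+2n≡i+n+n i n) bound
    where
    i+2n≡i+n+n : ∀ i n → i + 2 * n ≡ i + n + n
    i+2n≡i+n+n = solve-∀
  first : ∀ {m} → m < n → i + m < i + n + n
  first m<n = <-≤-trans (+-monoʳ-< i m<n) (m≤m+n (i + n) n)
  second : ∀ {m} → m < n → i + n + m < i + n + n
  second m<n = +-monoʳ-< (i + n) m<n

nonempty⇒0<length : ∀ (y : Word) → y ≢ [] → 0 < length y
nonempty⇒0<length []      y≢[] = ⊥-elim (y≢[] refl)
nonempty⇒0<length (_ ∷ _) _    = z<s

SquareAt⇒HasSquare : ∀ {f u i n} → BeginsWith f u → SquareAt f i n → i + 2 * n ≤ length u →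
  HasSquare u
SquareAt⇒HasSquare {f} {u} {i} {n} f⊒u (0<n , period) bound with m≤n⇒∃[o]m+o≡n bound
... | e , total = pref f i , half , rest , pref-nonempty (dropω i f) 0<n , decomposition
  where
  open ≡-Reasoning
  half half′ rest : Word
  half = pref (dropω i f) n
  half′ = pref (dropω (i + n) f) n
  rest = pref (dropω (i + n + n) f) e
  lengths : ∀ i n e → i + 2 * n + e ≡ i + n + n + e
  lengths = solve-∀
  decomposition : u ≡ pref f i ++ (half ++ half) ++ rest
  decomposition = begin
    u
      ≡⟨ sym f⊒u ⟩
    pref f (length u)
      ≡⟨ cong (pref f) (trans (sym total) (lengths i n e)) ⟩
    pref f (i + n + n + e)
      ≡⟨ pref-+ f (i + n + n) e ⟩
    pref f (i + n + n) ++ rest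
      ≡⟨ cong (_++ rest) (pref-+ f (i + n) n) ⟩
    (pref f (i + n) ++ half′) ++ rest
      ≡⟨ cong (λ w → (w ++ half′) ++ rest) (pref-+ f i n) ⟩
    ((pref f i ++ half) ++ half′) ++ rest
      ≡⟨ cong (λ w → ((pref f i ++ half) ++ w) ++ rest) (sym (pref-cong n period)) ⟩
    ((pref f i ++ half) ++ half) ++ rest
      ≡⟨ ++-assoc (pref f i ++ half) half rest ⟩
    (pref f i ++ half) ++ half ++ rest
      ≡⟨ ++-assoc (pref f i) half (half ++ rest) ⟩
    pref f i ++ half ++ half ++ rest
      ≡⟨ cong (pref f i ++_) (sym (++-assoc half half rest)) ⟩
    pref f i ++ (half ++ half) ++ rest
      ∎

square⇒SquareAt : ∀ {f} u {y v} → BeginsWith f (u ++ (y ++ y) ++ v) → y ≢ [] →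
  SquareAt f (length u) (length y)
square⇒SquareAt {f} u {y} {v} f⊒uyyv y≢[] = 0<length , λ m m<y →
  trans (pref-agree (length y) (trans first second⁻¹) m<y)
        (cong f (sym (+-assoc (length u) (length y) m)))
  where
  f⊒yyv : BeginsWith (dropω (length u) f) (y ++ y ++ v)
  f⊒yyv = subst (BeginsWith _) (++-assoc y y v) (BeginsWith-dropω u f⊒uyyv)
  first : BeginsWith (dropω (length u) f) y
  first = BeginsWith-++⁻ˡ y f⊒yyv
  second⁻¹ : y ≡ pref (dropω (length y) (dropω (length u) f)) (length y)
  second⁻¹ = sym (BeginsWith-++⁻ˡ y (BeginsWith-dropω y f⊒yyv))
  0<length : 0 < length y
  0<length = nonempty⇒0<length y y≢[]

SquareAt-translate : ∀ {h j n t r} → SquareAt h j n → SquareAt h t r → j ≤ t →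
  t + 2 * r ≤ j + n → SquareAt h (t + n) r
SquareAt-translate {h} {j} {n} {t} {r} (_ , period) (0<r , square) j≤t bound
  with m≤n⇒∃[o]m+o≡n j≤t
... | d , refl = 0<r , λ m m<r → begin
  h (j + d + n + m)           ≡⟨ cong h (reassoc₁ j d n m) ⟩
  h (j + n + (d + m))         ≡⟨ sym (period (d + m) (in-first-half′ m<r)) ⟩
  h (j + (d + m))             ≡⟨ cong h (sym (+-assoc j d m)) ⟩
  h (j + d + m)               ≡⟨ square m m<r ⟩
  h (j + d + r + m)           ≡⟨ cong h (reassoc₂ j d r m) ⟩
  h (j + (d + r + m))         ≡⟨ period (d + r + m) (in-first-half m<r) ⟩
  h (j + n + (d + r + m))     ≡⟨ cong h (reassoc₃ j d n r m) ⟩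
  h (j + d + n + r + m)       ∎
  where
  open ≡-Reasoning
  reassoc₁ : ∀ j d n m → j + d + n + m ≡ j + n + (d + m)
  reassoc₁ = solve-∀
  reassoc₂ : ∀ j d r m → j + d + r + m ≡ j + (d + r + m)
  reassoc₂ = solve-∀
  reassoc₃ : ∀ j d n r m → j + n + (d + r + m) ≡ j + d + n + r + m
  reassoc₃ = solve-∀
  d+2r≤n : d + r + r ≤ n
  d+2r≤n = +-cancelˡ-≤ j (d + r + r) n (subst (_≤ j + n) (reassoc₄ j d r) bound)
    where
    reassoc₄ : ∀ j d r → j + d + 2 * r ≡ j + (d + r + r)
    reassoc₄ = solve-∀
  in-first-half : ∀ {m} → m < r → d + r + m < n
  in-first-half m<r = <-≤-trans (+-monoʳ-< (d + r) m<r) d+2r≤n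
  in-first-half′ : ∀ {m} → m < r → d + m < n
  in-first-half′ {m} m<r = ≤-<-trans (+-monoˡ-≤ m (m≤m+n d r)) (in-first-half m<r)

¬≺-¬≻⇒≗ : ∀ {f g} → ¬ f ≺ g → ¬ g ≺ f → f ≗ g
¬≺-¬≻⇒≗ {f} {g} f⊀g g⊀f = <-rec (λ i → f i ≡ g i) agreeAt
  where
  agreeAt : ∀ i → (∀ {j} → j < i → f j ≡ g j) → f i ≡ g i
  agreeAt i below with <-cmp (f i) (g i)
  ... | tri< fi<gi _ _ = ⊥-elim (f⊀g (i , (λ _ → below) , fi<gi))
  ... | tri≈ _ fi≡gi _ = fi≡gi
  ... | tri> _ _ gi<fi = ⊥-elim (g⊀f (i , (λ j j<i → sym (below j<i)) , gi<fi))

≺-++ω⇒dropω-≺ : ∀ {f} u {v g} → BeginsWith f (u ++ v) → f ≺ (u ++ω g) →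
  dropω (length u) f ≺ g
≺-++ω⇒dropω-≺ []      _  f≺g = f≺g
≺-++ω⇒dropω-≺ (x ∷ u) eq (zero , _ , f0<x) = ⊥-elim (<-irrefl (∷-injectiveˡ eq) f0<x)
≺-++ω⇒dropω-≺ (x ∷ u) eq (suc i , agree , lt) =
  ≺-++ω⇒dropω-≺ u (∷-injectiveʳ eq) (i , (λ j j<i → agree (suc j) (s≤s j<i)) , lt)

Admissible-dropω : ∀ {f} u {v} → Admissible (u ++ v) f → Admissible v (dropω (length u) f)
Admissible-dropω {f} u (f⊒uv , within) =
  BeginsWith-dropω u f⊒uv ,
  SquaresWithin-dropω {f} (length u) (subst (SquaresWithin f) (length-++ u) within)

L[uv]⊀uL[v] : ∀ u {v f g} → IsL (u ++ v) f → IsL v g → ¬ f ≺ (u ++ω g)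
L[uv]⊀uL[v] u ((f⊒uv , within) , _) (_ , g-least) f≺ =
  g-least _ (Admissible-dropω u (f⊒uv , within)) (≺-++ω⇒dropω-≺ u f⊒uv f≺)

crossing-bound : ∀ t s j n r → 2 * (suc t + s) < j + 2 * n → suc s ≡ 2 * r → t + 2 * r ≤ j + n
crossing-bound t s j n r crosses 1+s≡2r = begin
  t + 2 * r      ≡⟨ cong (t +_) (sym 1+s≡2r) ⟩
  t + suc s      ≡⟨ +-suc t s ⟩
  suc t + s      <⟨ *-cancelˡ-< 2 (suc t + s) (j + n) (<-≤-trans crosses j+2n≤2[j+n]) ⟩
  j + n          ∎
  where
  open ≤-Reasoning
  j+2n≤2[j+n] : j + 2 * n ≤ 2 * (j + n)
  j+2n≤2[j+n] =
    ≤-trans (+-monoˡ-≤ (2 * n) (m≤n*m j 2)) (≤-reflexive (sym (*-distribˡ-+ 2 j n)))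

++ω-Admissible : ∀ {p s q a f g} → SquareFree (s ++ q) → LastLetter p a → IsSquare (a ∷ s) →
  Admissible (p ++ s ++ q) f → Admissible (s ++ q) g →
  pref f (2 * (length p + length s)) ≡ pref (p ++ω g) (2 * (length p + length s)) →
  Admissible (p ++ s ++ q) (p ++ω g)
++ω-Admissible {p} {s} {q} {a} {f} {g} sq-free (p′ , refl) (y , y≢[] , as≡yy)
               (_ , f-within) (g⊒sq , g-within) agree = BeginsWith-++ω p g⊒sq , within
  where
  h : InfWord
  h = p ++ω g
  N : ℕ
  N = 2 * (length p + length s)
  length-p : length p ≡ suc (length p′)
  length-p = trans (length-++ p′) (+-comm (length p′) 1)
  1+s≡2y : suc (length s) ≡ 2 * length y
  1+s≡2y = trans (cong length as≡yy)
                 (trans (length-++ y) (cong (length y +_) (sym (+-identityʳ (length y)))))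
  yy-in-h : SquareAt h (length p′) (length y)
  yy-in-h = square⇒SquareAt p′ (subst (BeginsWith h) w≡p′yyq (BeginsWith-++ω p g⊒sq)) y≢[]
    where
    w≡p′yyq : p ++ s ++ q ≡ p′ ++ (y ++ y) ++ q
    w≡p′yyq = trans (++-assoc p′ [ a ] (s ++ q)) (cong (λ z → p′ ++ z ++ q) as≡yy)
  crossing : ∀ {j n} → SquareAt h j n → j < length p → N < j + 2 * n → HasSquare (s ++ q)
  crossing {n = zero} (() , _)
  crossing {j} {suc n} sq j<p N<end =
    SquareAt⇒HasSquare g⊒sq in-g (g-within n (length y) in-g)
    where
    translated : SquareAt h (length p′ + suc n) (length y)
    translated = SquareAt-translate {h} sq yy-in-h (≤-pred (subst (j <_) length-p j<p))
      (crossing-bound (length p′) (length s) j (suc n) (length y)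
        (subst (λ P → 2 * (P + length s) < j + 2 * suc n) length-p N<end) 1+s≡2y)
    in-g : SquareAt g n (length y)
    in-g = SquareAt-++ω⁻ p (subst (λ i → SquareAt h i (length y))
                                  (trans (+-suc (length p′) n) (cong (_+ n) (sym length-p))) translated)
  within : SquaresWithin h (length (p ++ s ++ q))
  within j n sq with length p ≤? j | j + 2 * n ≤? N
  ... | yes p≤j | _            = subst (j + 2 * n ≤_) (sym (length-++ p))
                                   (SquaresWithin-++ω p g-within p≤j sq)
  ... | no  p≰j | yes in-prefix = f-within j n (SquareAt-pref agree in-prefix sq)
  ... | no  p≰j | no  crosses   = ⊥-elim (sq-free (crossing sq (≰⇒> p≰j) (≰⇒> crosses)))

theorem5p6 : (w p s q : Word) (a : ℕ) (f g : InfWord) →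
    w ≢ [] → HasSquare w →
    w ≡ p ++ s ++ q →
    IsLongestSquareFreeSuffix (s ++ q) w →
    LastLetter p a →
    IsLongestSquarePrefix (a ∷ s) (a ∷ (s ++ q)) →
    IsL (p ++ s ++ q) f → IsL (s ++ q) g →
    ((∀ i → f i ≡ (p ++ω g) i) ⇔
     (pref f (2 * (length p + length s)) ≡ pref (p ++ω g) (2 * (length p + length s))))
theorem5p6 w p s q a f g _ _ _ (_ , sq-free , _) last (_ , as-square , _) Lf Lg =
  mk⇔ (λ f≗pg → pref-cong _ (λ k _ → f≗pg k))
      (λ agree → ¬≺-¬≻⇒≗ (L[uv]⊀uL[v] p Lf Lg)
                        (proj₂ Lf (p ++ω g)
                           (++ω-Admissible sq-free last as-square (proj₁ Lf) (proj₁ Lg) agree)))
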